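{- Let $H$ be a $2$-edge-connected undirected graph and $T$ a DFS tree of $H$ rooted at $r$, with vertices identified with their DFS numbers. Let $u,v\neq r$ be vertices such that $M(u)=M(v)$, $v$ is an ancestor of $u$, and $\mathit{high}(u)<v$. Then $\mathit{high}(u)=\mathit{high}(v)$.
   Context: Vertices are numbered in DFS discovery order and identified with these numbers. Every vertex is an ancestor and descendant of itself. Edges not in $T$ are back-edges, each joining a vertex to an ancestor. For $x\neq r$: $\mathit{high}(x)$ is the maximum proper ancestor of $x$ joined by a back-edge to a descendant of $x$; $M(x)$ is the nearest common ancestor of all descendants of $x$ joined by a back-edge to a proper ancestor of $x$. -}

module Defs where

open import Data.Nat using (ℕ; suc)
open import Data.Fin using (Fin; zero; suc; inject₁; _≤_; _<_)
open import Data.Product using (_×_; _,_; ∃; ∃-syntax)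
open import Data.Sum using (_⊎_)
open import Data.Unit using (⊤)
open import Relation.Binary.PropositionalEquality using (_≡_; _≢_)

-- An undirected multigraph H with vertex set Fin N and m edges;
-- edge e has (unordered) endpoints ends e.
Joins : ∀ {N m} → (Fin m → Fin N × Fin N) → Fin m → Fin N → Fin N → Set
Joins ends e x y = (ends e ≡ (x , y)) ⊎ (ends e ≡ (y , x))

data Walk {N m} (ends : Fin m → Fin N × Fin N) (allowed : Fin m → Set)
     : Fin N → Fin N → Set where
  here : ∀ {x} → Walk ends allowed x x
  step : ∀ {x y z} (f : Fin m) → allowed f → Joins ends f x y →
         Walk ends allowed y z → Walk ends allowed x z

Connected : ∀ {N m} → (Fin m → Fin N × Fin N) → Set
Connected ends = ∀ x y → Walk ends (λ _ → ⊤) x y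

TwoEdgeConnected : ∀ {N m} → (Fin m → Fin N × Fin N) → Set
TwoEdgeConnected {m = m} ends =
  Connected ends × (∀ (e : Fin m) x y → Walk ends (λ f → f ≢ e) x y)

-- Ancestor relation of the rooted tree given by a parent function on
-- Fin (suc n); the root is zero (DFS number 0), non-root vertices are suc w.
-- Every vertex is an ancestor of itself.
data Anc {n} (parent : Fin (suc n) → Fin (suc n)) : Fin (suc n) → Fin (suc n) → Set where
  anc-refl : ∀ {a} → Anc parent a a
  anc-step : ∀ {a} (w : Fin n) → Anc parent a (parent (suc w)) → Anc parent a (suc w)

-- A DFS tree T of H rooted at r = zero, vertices identified with their DFS
-- (preorder discovery) numbers.
record DFSTree {n m} (ends : Fin m → Fin (suc n) × Fin (suc n)) : Set where
  field
    parent     : Fin (suc n) → Fin (suc n)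
    parent<    : ∀ (w : Fin n) → parent (suc w) < suc w
    treeEdge   : Fin n → Fin m
    treeEdge-joins : ∀ (w : Fin n) → Joins ends (treeEdge w) (suc w) (parent (suc w))
    treeEdge-inj   : ∀ (w w' : Fin n) → treeEdge w ≡ treeEdge w' → w ≡ w'
    -- DFS discovery (preorder) numbering: the vertex numbered v-1 lies in
    -- the subtree of the parent of v
    preorder   : ∀ (w : Fin n) → Anc parent (parent (suc w)) (inject₁ w)
    nontree-anc : ∀ (e : Fin m) → (∀ w → treeEdge w ≢ e) →
                  ∀ x y → Joins ends e x y → Anc parent x y ⊎ Anc parent y x

module _ {n m} {ends : Fin m → Fin (suc n) × Fin (suc n)} (T : DFSTree ends) where
  open DFSTree T

  Ancestor : Fin (suc n) → Fin (suc n) → Set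
  Ancestor = Anc parent

  ProperAncestor : Fin (suc n) → Fin (suc n) → Set
  ProperAncestor a x = Ancestor a x × a ≢ x

  BackEdge : Fin m → Set
  BackEdge e = ∀ w → treeEdge w ≢ e

  HighCand : Fin (suc n) → Fin (suc n) → Set
  HighCand x h = ProperAncestor h x ×
                 ∃[ e ] ∃[ y ] (BackEdge e × Ancestor x y × Joins ends e y h)

  IsHigh : Fin (suc n) → Fin (suc n) → Set
  IsHigh x h = HighCand x h × (∀ h' → HighCand x h' → h' ≤ h)

  MSet : Fin (suc n) → Fin (suc n) → Set
  MSet x y = Ancestor x y ×
             ∃[ e ] ∃[ a ] (BackEdge e × ProperAncestor a x × Joins ends e y a)

  IsM : Fin (suc n) → Fin (suc n) → Set
  IsM x c = (∀ y → MSet x y → Ancestor c y) ×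
            (∀ c' → (∀ y → MSet x y → Ancestor c' y) → Ancestor c' c)

module Submission where

-- Ancestors of a vertex are numbered before it, so the ancestor
-- relation refines the DFS order; moreover the ancestors of a fixed vertex
-- form a chain.  Let v be an ancestor of u with M(u) = M(v) = c and
-- high(u) = h < v.
--   * h is a high-candidate of v: it is an ancestor of u, hence comparable
--     with v, and h < v forces h to be an ancestor of v; the back-edge
--     witnessing h for u also starts at a descendant of v.
--   * every high-candidate h' of v is one of u: its back-edge starts at a
--     vertex of MSet(v), hence at a descendant of M(v) = M(u), which is a
--     descendant of u; and a proper ancestor of v is one of u.
-- So h' ≤ h for all candidates of v, i.e. high(v) = h.

open import Defs
open import Data.Nat using (suc)
open import Data.Fin using (Fin; zero; _<_; _≤_)
open import Data.Product using (_×_; _,_; proj₁)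
open import Data.Sum using (_⊎_; inj₁; inj₂)
open import Data.Empty using (⊥-elim)
open import Relation.Binary.PropositionalEquality using (_≢_; refl)
import Data.Fin.Properties as FinP
import Data.Nat.Properties as NatP

module _ {n m} {ends : Fin m → Fin (suc n) × Fin (suc n)} (T : DFSTree ends) where
  open DFSTree T

  anc⇒≤ : ∀ {a x} → Ancestor T a x → a ≤ x
  anc⇒≤ anc-refl = FinP.≤-refl
  anc⇒≤ (anc-step w p) = FinP.≤-trans (anc⇒≤ p) (NatP.<⇒≤ (parent< w))

  anc-trans : ∀ {a b c} → Ancestor T a b → Ancestor T b c → Ancestor T a c
  anc-trans p anc-refl = p
  anc-trans p (anc-step w q) = anc-step w (anc-trans p q)

  anc-linear : ∀ {a b x} → Ancestor T a x → Ancestor T b x →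
               Ancestor T a b ⊎ Ancestor T b a
  anc-linear anc-refl q = inj₂ q
  anc-linear (anc-step w p) anc-refl = inj₁ (anc-step w p)
  anc-linear (anc-step w p) (anc-step .w q) = anc-linear p q

  -- A proper ancestor of b is a proper ancestor of every descendant of b
  -- (by antisymmetry of ≤, a cannot reappear below b).
  proper-anc-trans : ∀ {a b x} → ProperAncestor T a b → Ancestor T b x →
                     ProperAncestor T a x
  proper-anc-trans {a} {b} {x} (ab , a≢b) bx = anc-trans ab bx , a≢x
    where
    a≢x : a ≢ x
    a≢x refl = a≢b (FinP.≤-antisym (anc⇒≤ ab) (anc⇒≤ bx))

  -- If c is the nearest common ancestor of MSet x, it lies below x,
  -- since x itself is a common ancestor of MSet x.
  M-below : ∀ {x c} → IsM T x c → Ancestor T x c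
  M-below (_ , nearest) = nearest _ (λ _ y∈M → proj₁ y∈M)

  -- A high-candidate h of u that precedes an ancestor v of u is a
  -- high-candidate of v: h is comparable with v, hence above it.
  highCand-up : ∀ {u h v} → Ancestor T v u → h < v →
                HighCand T u h → HighCand T v h
  highCand-up {h = h} {v} vu h<v ((hu , _) , e , y , back , uy , joins) =
    (h-anc-v , FinP.<⇒≢ h<v) , e , y , back , anc-trans vu uy , joins
    where
    h-anc-v : Ancestor T h v
    h-anc-v with anc-linear hu vu
    ... | inj₁ hv = hv
    ... | inj₂ vh = ⊥-elim (NatP.<⇒≱ h<v (anc⇒≤ vh))

  -- If v is an ancestor of u and all of MSet v lies below u, then every
  -- high-candidate of v is a high-candidate of u: its back-edge starts in
  -- MSet v.
  highCand-down : ∀ {u v h} → Ancestor T v u →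
                  (∀ y → MSet T v y → Ancestor T u y) →
                  HighCand T v h → HighCand T u h
  highCand-down vu Mv-below-u (hv , e , y , back , vy , joins) =
    proper-anc-trans hv vu , e , y , back ,
    Mv-below-u y (vy , e , _ , back , hv , joins) , joins

lemma10 : ∀ {n m} (ends : Fin m → Fin (suc n) × Fin (suc n)) →
    TwoEdgeConnected ends → (T : DFSTree ends) →
    ∀ (u v : Fin (suc n)) → u ≢ zero → v ≢ zero →
    ∀ (c : Fin (suc n)) → IsM T u c → IsM T v c →
    Ancestor T v u →
    ∀ (h : Fin (suc n)) → IsHigh T u h → h < v →
    IsHigh T v h
lemma10 ends _ T u v _ _ c Mu (Mv-common , _) vu h (h-cand , h-max) h<v =
  highCand-up T vu h<v h-cand ,
  λ h' h'-cand → h-max h' (highCand-down T vu Mv-below-u h'-cand)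
  where
  -- MSet v lies below M(v) = M(u), which lies below u.
  Mv-below-u : ∀ y → MSet T v y → Ancestor T u y
  Mv-below-u y y∈Mv = anc-trans T (M-below T Mu) (Mv-common y y∈Mv)
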